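{- For every bunched context $\Delta'(-)$, bunch $\Delta$ and formula $\chi$: if $\Delta'(\lceil\Delta\rceil)\vdash_{\mathsf{cf}}\chi$ then $\Delta'(\Delta)\vdash_{\mathsf{cf}}\chi$.
   Context: Formulas of BI: $\varphi,\psi ::= \top \mid \bot \mid \varphi\wedge\psi \mid \varphi\vee\psi \mid \varphi\to\psi \mid \mathsf{emp} \mid \varphi * \psi \mid \varphi \mathrel{ -\!\!*} \psi \mid a$ ($a\in\mathrm{Atom}$). Bunches: $\Delta ::= \varphi \mid \varnothing_m \mid \varnothing_a \mid \Delta , \Delta \mid \Delta ; \Delta$. A bunched context $\Delta(-)$ is a bunch with one hole; $\Delta(\Gamma)$ fills it. Bunch equivalence $\equiv$: least equivalence relation, closed under bunched contexts, making "$,$" commutative and associative with unit $\varnothing_m$ and "$;$" commutative and associative with unit $\varnothing_a$. The BI sequent calculus: (ax) $a\vdash a$ for atoms $a$; (equiv) from $\Delta'\vdash\varphi$, $\Delta\equiv\Delta'$ infer $\Delta\vdash\varphi$; (W;) from $\Delta(\Delta_1)\vdash\varphi$ infer $\Delta(\Delta_1;\Delta_2)\vdash\varphi$; (C;) from $\Delta(\Delta_1;\Delta_1)\vdash\varphi$ infer $\Delta(\Delta_1)\vdash\varphi$; (cut) from $\Delta'\vdash A$, $\Delta(A)\vdash B$ infer $\Delta(\Delta')\vdash B$; (empR) $\varnothing_m\vdash\mathsf{emp}$; (empL) from $\Delta(\varnothing_m)\vdash\varphi$ infer $\Delta(\mathsf{emp})\vdash\varphi$; (*R) from $\Delta_1\vdash\varphi$,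 $\Delta_2\vdash\psi$ infer $\Delta_1,\Delta_2\vdash\varphi*\psi$; (*L) from $\Delta(\varphi,\psi)\vdash\chi$ infer $\Delta(\varphi*\psi)\vdash\chi$; ($-\!*$R) from $\Delta,\varphi\vdash\psi$ infer $\Delta\vdash\varphi\mathrel{ -\!\!*}\psi$; ($-\!*$L) from $\Delta_1\vdash\varphi$, $\Delta(\Delta_2,\psi)\vdash\chi$ infer $\Delta((\Delta_1,\Delta_2),\varphi\mathrel{ -\!\!*}\psi)\vdash\chi$; ($\top$R) $\varnothing_a\vdash\top$; ($\top$L) from $\Delta(\varnothing_a)\vdash\varphi$ infer $\Delta(\top)\vdash\varphi$; ($\wedge$R) from $\Delta_1\vdash\varphi$, $\Delta_2\vdash\psi$ infer $\Delta_1;\Delta_2\vdash\varphi\wedge\psi$; ($\wedge$L) from $\Delta(\varphi;\psi)\vdash\chi$ infer $\Delta(\varphi\wedge\psi)\vdash\chi$; ($\to$R) from $\Delta;\varphi\vdash\psi$ infer $\Delta\vdash\varphi\to\psi$; ($\to$L) from $\Delta_1\vdash\varphi$, $\Delta(\Delta_2;\psi)\vdash\chi$ infer $\Delta((\Delta_1;\Delta_2);\varphi\to\psi)\vdash\chi$; ($\bot$L) $\Delta(\bot)\vdash\varphi$; ($\vee$R1/2) from $\Delta\vdash\varphi$ (resp. $\Delta\vdash\psi$) infer $\Delta\vdash\varphi\vee\psi$; ($\vee$L) from $\Delta(\varphi)\vdash\chi$, $\Delta(\psi)\vdash\chi$ infer $\Delta(\varphi\vee\psi)\vdash\chi$. $\Delta\vdash_{\mathsf{cf}}\varphi$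 means derivable without (cut). $\lceil\Delta\rceil$ is the formula obtained from $\Delta$ by replacing "$,$" by $*$, "$;$" by $\wedge$, $\varnothing_m$ by $\mathsf{emp}$, $\varnothing_a$ by $\top$; in $\Delta'(\lceil\Delta\rceil)$ it is a single leaf. -}

module Defs where

open import Level using (Level)

data Form {a : Level} (A : Set a) : Set a where
  ⊤ᶠ ⊥ᶠ empᶠ : Form A
  _∧ᶠ_ _∨ᶠ_ _⇒ᶠ_ _✱_ _-✱_ : Form A → Form A → Form A
  atom : A → Form A

data Bunch {a : Level} (A : Set a) : Set a where
  leaf : Form A → Bunch A
  ∅m ∅a : Bunch A
  _,ᵇ_ _⨾ᵇ_ : Bunch A → Bunch A → Bunch A

data Ctx {a : Level} (A : Set a) : Set a where
  hole : Ctx A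
  _,ˡ_ : Ctx A → Bunch A → Ctx A
  _,ʳ_ : Bunch A → Ctx A → Ctx A
  _⨾ˡ_ : Ctx A → Bunch A → Ctx A
  _⨾ʳ_ : Bunch A → Ctx A → Ctx A

module _ {a : Level} {A : Set a} where

  _[_] : Ctx A → Bunch A → Bunch A
  hole [ Γ ] = Γ
  (C ,ˡ Δ) [ Γ ] = (C [ Γ ]) ,ᵇ Δ
  (Δ ,ʳ C) [ Γ ] = Δ ,ᵇ (C [ Γ ])
  (C ⨾ˡ Δ) [ Γ ] = (C [ Γ ]) ⨾ᵇ Δ
  (Δ ⨾ʳ C) [ Γ ] = Δ ⨾ᵇ (C [ Γ ])

  ⌈_⌉ : Bunch A → Form A
  ⌈ leaf φ ⌉ = φ
  ⌈ ∅m ⌉ = empᶠ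
  ⌈ ∅a ⌉ = ⊤ᶠ
  ⌈ Δ₁ ,ᵇ Δ₂ ⌉ = ⌈ Δ₁ ⌉ ✱ ⌈ Δ₂ ⌉
  ⌈ Δ₁ ⨾ᵇ Δ₂ ⌉ = ⌈ Δ₁ ⌉ ∧ᶠ ⌈ Δ₂ ⌉

  data _≡ᵇ_ : Bunch A → Bunch A → Set a where
    ≡-refl  : ∀ {Δ} → Δ ≡ᵇ Δ
    ≡-sym   : ∀ {Δ Δ'} → Δ ≡ᵇ Δ' → Δ' ≡ᵇ Δ
    ≡-trans : ∀ {Δ₁ Δ₂ Δ₃} → Δ₁ ≡ᵇ Δ₂ → Δ₂ ≡ᵇ Δ₃ → Δ₁ ≡ᵇ Δ₃
    ≡-ctx   : ∀ (C : Ctx A) {Γ Γ'} → Γ ≡ᵇ Γ' → (C [ Γ ]) ≡ᵇ (C [ Γ' ])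
    ,-comm  : ∀ {Δ₁ Δ₂} → (Δ₁ ,ᵇ Δ₂) ≡ᵇ (Δ₂ ,ᵇ Δ₁)
    ,-assoc : ∀ {Δ₁ Δ₂ Δ₃} → ((Δ₁ ,ᵇ Δ₂) ,ᵇ Δ₃) ≡ᵇ (Δ₁ ,ᵇ (Δ₂ ,ᵇ Δ₃))
    ,-unit  : ∀ {Δ} → (Δ ,ᵇ ∅m) ≡ᵇ Δ
    ⨾-comm  : ∀ {Δ₁ Δ₂} → (Δ₁ ⨾ᵇ Δ₂) ≡ᵇ (Δ₂ ⨾ᵇ Δ₁)
    ⨾-assoc : ∀ {Δ₁ Δ₂ Δ₃} → ((Δ₁ ⨾ᵇ Δ₂) ⨾ᵇ Δ₃) ≡ᵇ (Δ₁ ⨾ᵇ (Δ₂ ⨾ᵇ Δ₃))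
    ⨾-unit  : ∀ {Δ} → (Δ ⨾ᵇ ∅a) ≡ᵇ Δ

  -- cut-free BI sequent calculus (all rules except (cut))
  data _⊢cf_ : Bunch A → Form A → Set a where
    ax    : ∀ {p} → leaf (atom p) ⊢cf atom p
    equiv : ∀ {Δ Δ' φ} → Δ' ⊢cf φ → Δ ≡ᵇ Δ' → Δ ⊢cf φ
    W⨾    : ∀ (C : Ctx A) {Δ₁ Δ₂ φ} → (C [ Δ₁ ]) ⊢cf φ → (C [ Δ₁ ⨾ᵇ Δ₂ ]) ⊢cf φ
    C⨾    : ∀ (C : Ctx A) {Δ₁ φ} → (C [ Δ₁ ⨾ᵇ Δ₁ ]) ⊢cf φ → (C [ Δ₁ ]) ⊢cf φ
    empR  : ∅m ⊢cf empᶠ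
    empL  : ∀ (C : Ctx A) {φ} → (C [ ∅m ]) ⊢cf φ → (C [ leaf empᶠ ]) ⊢cf φ
    ✱R    : ∀ {Δ₁ Δ₂ φ ψ} → Δ₁ ⊢cf φ → Δ₂ ⊢cf ψ → (Δ₁ ,ᵇ Δ₂) ⊢cf (φ ✱ ψ)
    ✱L    : ∀ (C : Ctx A) {φ ψ χ} → (C [ leaf φ ,ᵇ leaf ψ ]) ⊢cf χ → (C [ leaf (φ ✱ ψ) ]) ⊢cf χ
    -✱R   : ∀ {Δ φ ψ} → (Δ ,ᵇ leaf φ) ⊢cf ψ → Δ ⊢cf (φ -✱ ψ)
    -✱L   : ∀ (C : Ctx A) {Δ₁ Δ₂ φ ψ χ} → Δ₁ ⊢cf φ → (C [ Δ₂ ,ᵇ leaf ψ ]) ⊢cf χ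
            → (C [ (Δ₁ ,ᵇ Δ₂) ,ᵇ leaf (φ -✱ ψ) ]) ⊢cf χ
    ⊤R    : ∅a ⊢cf ⊤ᶠ
    ⊤L    : ∀ (C : Ctx A) {φ} → (C [ ∅a ]) ⊢cf φ → (C [ leaf ⊤ᶠ ]) ⊢cf φ
    ∧R    : ∀ {Δ₁ Δ₂ φ ψ} → Δ₁ ⊢cf φ → Δ₂ ⊢cf ψ → (Δ₁ ⨾ᵇ Δ₂) ⊢cf (φ ∧ᶠ ψ)
    ∧L    : ∀ (C : Ctx A) {φ ψ χ} → (C [ leaf φ ⨾ᵇ leaf ψ ]) ⊢cf χ → (C [ leaf (φ ∧ᶠ ψ) ]) ⊢cf χ
    ⇒R    : ∀ {Δ φ ψ} → (Δ ⨾ᵇ leaf φ) ⊢cf ψ → Δ ⊢cf (φ ⇒ᶠ ψ)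
    ⇒L    : ∀ (C : Ctx A) {Δ₁ Δ₂ φ ψ χ} → Δ₁ ⊢cf φ → (C [ Δ₂ ⨾ᵇ leaf ψ ]) ⊢cf χ
            → (C [ (Δ₁ ⨾ᵇ Δ₂) ⨾ᵇ leaf (φ ⇒ᶠ ψ) ]) ⊢cf χ
    ⊥L    : ∀ (C : Ctx A) {φ} → (C [ leaf ⊥ᶠ ]) ⊢cf φ
    ∨R₁   : ∀ {Δ φ ψ} → Δ ⊢cf φ → Δ ⊢cf (φ ∨ᶠ ψ)
    ∨R₂   : ∀ {Δ φ ψ} → Δ ⊢cf ψ → Δ ⊢cf (φ ∨ᶠ ψ)
    ∨L    : ∀ (C : Ctx A) {φ ψ χ} → (C [ leaf φ ]) ⊢cf χ → (C [ leaf ψ ]) ⊢cf χ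
            → (C [ leaf (φ ∨ᶠ ψ) ]) ⊢cf χ

-- The left rules for emp, ⊤, ∗ and ∧ are invertible in the cut-free calculus.
-- We prove this in a simultaneous form: replacing any set of leaves emp, ⊤, φ ∗ ψ,
-- φ ∧ ψ by ∅m, ∅a, (φ , ψ), (φ ; ψ) preserves cut-free derivability.  The proof is
-- by induction on the derivation: where a replaced leaf is principal, the rule is
-- simply dropped, since its premise is already the replaced sequent; all other rules,
-- bunch equivalences included, commute with the replacement.  Simultaneity is what
-- makes contraction go through, as it duplicates replaced leaves.  Turning ⌈ Δ ⌉ back
-- into Δ is a finite sequence of such replacements.
module Submission where

open import Level using (Level)
open import Data.Product using (_×_; _,_; ∃-syntax)
open import Relation.Binary.PropositionalEquality using (_≡_; refl)
open import Relation.Binary.Construct.Closure.ReflexiveTransitive using (Star; ε; _◅_; _◅◅_; gmap)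

open import Defs

module _ {a : Level} {A : Set a} where

  data Unfolds : Form A → Bunch A → Set a where
    emp-unfolds : Unfolds empᶠ ∅m
    ⊤-unfolds   : Unfolds ⊤ᶠ ∅a
    ✱-unfolds   : ∀ {φ ψ} → Unfolds (φ ✱ ψ) (leaf φ ,ᵇ leaf ψ)
    ∧-unfolds   : ∀ {φ ψ} → Unfolds (φ ∧ᶠ ψ) (leaf φ ⨾ᵇ leaf ψ)

  infix 4 _↝_ _↝ᶜ_ _↝*_

  data _↝_ : Bunch A → Bunch A → Set a where
    keep   : ∀ {φ} → leaf φ ↝ leaf φ
    unfold : ∀ {φ Γ} → Unfolds φ Γ → leaf φ ↝ Γ
    ∅m↝    : ∅m ↝ ∅m
    ∅a↝    : ∅a ↝ ∅a
    _,↝_   : ∀ {Δ₁ Δ₂ Γ₁ Γ₂} → Δ₁ ↝ Γ₁ → Δ₂ ↝ Γ₂ → (Δ₁ ,ᵇ Δ₂) ↝ (Γ₁ ,ᵇ Γ₂)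
    _⨾↝_   : ∀ {Δ₁ Δ₂ Γ₁ Γ₂} → Δ₁ ↝ Γ₁ → Δ₂ ↝ Γ₂ → (Δ₁ ⨾ᵇ Δ₂) ↝ (Γ₁ ⨾ᵇ Γ₂)

  data _↝ᶜ_ : Ctx A → Ctx A → Set a where
    hole↝ : hole ↝ᶜ hole
    _,ˡ↝_ : ∀ {C C' Δ Δ'} → C ↝ᶜ C' → Δ ↝ Δ' → (C ,ˡ Δ) ↝ᶜ (C' ,ˡ Δ')
    _,ʳ↝_ : ∀ {C C' Δ Δ'} → Δ ↝ Δ' → C ↝ᶜ C' → (Δ ,ʳ C) ↝ᶜ (Δ' ,ʳ C')
    _⨾ˡ↝_ : ∀ {C C' Δ Δ'} → C ↝ᶜ C' → Δ ↝ Δ' → (C ⨾ˡ Δ) ↝ᶜ (C' ⨾ˡ Δ')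
    _⨾ʳ↝_ : ∀ {C C' Δ Δ'} → Δ ↝ Δ' → C ↝ᶜ C' → (Δ ⨾ʳ C) ↝ᶜ (Δ' ⨾ʳ C')

  ↝-refl : ∀ Δ → Δ ↝ Δ
  ↝-refl (leaf φ)   = keep
  ↝-refl ∅m         = ∅m↝
  ↝-refl ∅a         = ∅a↝
  ↝-refl (Δ₁ ,ᵇ Δ₂) = ↝-refl Δ₁ ,↝ ↝-refl Δ₂
  ↝-refl (Δ₁ ⨾ᵇ Δ₂) = ↝-refl Δ₁ ⨾↝ ↝-refl Δ₂

  ↝ᶜ-refl : ∀ C → C ↝ᶜ C
  ↝ᶜ-refl hole     = hole↝
  ↝ᶜ-refl (C ,ˡ Δ) = ↝ᶜ-refl C ,ˡ↝ ↝-refl Δ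
  ↝ᶜ-refl (Δ ,ʳ C) = ↝-refl Δ ,ʳ↝ ↝ᶜ-refl C
  ↝ᶜ-refl (C ⨾ˡ Δ) = ↝ᶜ-refl C ⨾ˡ↝ ↝-refl Δ
  ↝ᶜ-refl (Δ ⨾ʳ C) = ↝-refl Δ ⨾ʳ↝ ↝ᶜ-refl C

  ↝-fill : ∀ {C C' X X'} → C ↝ᶜ C' → X ↝ X' → (C [ X ]) ↝ (C' [ X' ])
  ↝-fill hole↝     x = x
  ↝-fill (c ,ˡ↝ d) x = ↝-fill c x ,↝ d
  ↝-fill (d ,ʳ↝ c) x = d ,↝ ↝-fill c x
  ↝-fill (c ⨾ˡ↝ d) x = ↝-fill c x ⨾↝ d
  ↝-fill (d ⨾ʳ↝ c) x = d ⨾↝ ↝-fill c x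

  record Unfilled (C : Ctx A) (X Γ : Bunch A) : Set a where
    constructor unfilled
    field
      {C'} : Ctx A
      {X'} : Bunch A
      ctx↝  : C ↝ᶜ C'
      fill↝ : X ↝ X'
      fills : Γ ≡ (C' [ X' ])

  ↝-unfill : ∀ C {X Γ} → (C [ X ]) ↝ Γ → Unfilled C X Γ
  ↝-unfill hole r = unfilled hole↝ r refl
  ↝-unfill (C ,ˡ Δ) (r ,↝ s) with unfilled c x refl ← ↝-unfill C r = unfilled (c ,ˡ↝ s) x refl
  ↝-unfill (Δ ,ʳ C) (s ,↝ r) with unfilled c x refl ← ↝-unfill C r = unfilled (s ,ʳ↝ c) x refl
  ↝-unfill (C ⨾ˡ Δ) (r ⨾↝ s) with unfilled c x refl ← ↝-unfill C r = unfilled (c ⨾ˡ↝ s) x refl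
  ↝-unfill (Δ ⨾ʳ C) (s ⨾↝ r) with unfilled c x refl ← ↝-unfill C r = unfilled (s ⨾ʳ↝ c) x refl

  ↝-push-≡ᵇ : ∀ {Δ Δ' Γ} → Δ ≡ᵇ Δ' → Δ ↝ Γ → ∃[ Γ' ] (Δ' ↝ Γ' × Γ ≡ᵇ Γ')
  ↝-pull-≡ᵇ : ∀ {Δ Δ' Γ'} → Δ ≡ᵇ Δ' → Δ' ↝ Γ' → ∃[ Γ ] (Δ ↝ Γ × Γ ≡ᵇ Γ')

  ↝-push-≡ᵇ ≡-refl r = _ , r , ≡-refl
  ↝-push-≡ᵇ (≡-sym e) r with _ , r' , q ← ↝-pull-≡ᵇ e r = _ , r' , ≡-sym q
  ↝-push-≡ᵇ (≡-trans e₁ e₂) r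
    with _ , r₁ , q₁ ← ↝-push-≡ᵇ e₁ r
    with _ , r₂ , q₂ ← ↝-push-≡ᵇ e₂ r₁ = _ , r₂ , ≡-trans q₁ q₂
  ↝-push-≡ᵇ (≡-ctx C e) r
    with unfilled c x refl ← ↝-unfill C r
    with _ , x' , q ← ↝-push-≡ᵇ e x = _ , ↝-fill c x' , ≡-ctx _ q
  ↝-push-≡ᵇ ,-comm (r ,↝ s) = _ , s ,↝ r , ,-comm
  ↝-push-≡ᵇ ,-assoc ((r ,↝ s) ,↝ t) = _ , r ,↝ (s ,↝ t) , ,-assoc
  ↝-push-≡ᵇ ,-unit (r ,↝ ∅m↝) = _ , r , ,-unit
  ↝-push-≡ᵇ ⨾-comm (r ⨾↝ s) = _ , s ⨾↝ r , ⨾-comm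
  ↝-push-≡ᵇ ⨾-assoc ((r ⨾↝ s) ⨾↝ t) = _ , r ⨾↝ (s ⨾↝ t) , ⨾-assoc
  ↝-push-≡ᵇ ⨾-unit (r ⨾↝ ∅a↝) = _ , r , ⨾-unit

  ↝-pull-≡ᵇ ≡-refl r = _ , r , ≡-refl
  ↝-pull-≡ᵇ (≡-sym e) r with _ , r' , q ← ↝-push-≡ᵇ e r = _ , r' , ≡-sym q
  ↝-pull-≡ᵇ (≡-trans e₁ e₂) r
    with _ , r₂ , q₂ ← ↝-pull-≡ᵇ e₂ r
    with _ , r₁ , q₁ ← ↝-pull-≡ᵇ e₁ r₂ = _ , r₁ , ≡-trans q₁ q₂
  ↝-pull-≡ᵇ (≡-ctx C e) r
    with unfilled c x refl ← ↝-unfill C r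
    with _ , x' , q ← ↝-pull-≡ᵇ e x = _ , ↝-fill c x' , ≡-ctx _ q
  ↝-pull-≡ᵇ ,-comm (r ,↝ s) = _ , s ,↝ r , ,-comm
  ↝-pull-≡ᵇ ,-assoc (r ,↝ (s ,↝ t)) = _ , (r ,↝ s) ,↝ t , ,-assoc
  ↝-pull-≡ᵇ ,-unit r = _ , r ,↝ ∅m↝ , ,-unit
  ↝-pull-≡ᵇ ⨾-comm (r ⨾↝ s) = _ , s ⨾↝ r , ⨾-comm
  ↝-pull-≡ᵇ ⨾-assoc (r ⨾↝ (s ⨾↝ t)) = _ , (r ⨾↝ s) ⨾↝ t , ⨾-assoc
  ↝-pull-≡ᵇ ⨾-unit r = _ , r ⨾↝ ∅a↝ , ⨾-unit

  ⊢cf-↝ : ∀ {Γ Γ' χ} → Γ ⊢cf χ → Γ ↝ Γ' → Γ' ⊢cf χ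
  ⊢cf-↝ ax keep = ax
  ⊢cf-↝ ax (unfold ())
  ⊢cf-↝ (equiv d e) r with _ , r' , q ← ↝-push-≡ᵇ e r = equiv (⊢cf-↝ d r') q
  ⊢cf-↝ (W⨾ C d) r with unfilled c (x ⨾↝ _) refl ← ↝-unfill C r = W⨾ _ (⊢cf-↝ d (↝-fill c x))
  ⊢cf-↝ (C⨾ C d) r with unfilled c x refl ← ↝-unfill C r = C⨾ _ (⊢cf-↝ d (↝-fill c (x ⨾↝ x)))
  ⊢cf-↝ empR ∅m↝ = empR
  ⊢cf-↝ (empL C d) r with ↝-unfill C r
  ... | unfilled c keep refl                = empL _ (⊢cf-↝ d (↝-fill c ∅m↝))
  ... | unfilled c (unfold emp-unfolds) refl = ⊢cf-↝ d (↝-fill c ∅m↝)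
  ⊢cf-↝ (✱R d₁ d₂) (r₁ ,↝ r₂) = ✱R (⊢cf-↝ d₁ r₁) (⊢cf-↝ d₂ r₂)
  ⊢cf-↝ (✱L C d) r with ↝-unfill C r
  ... | unfilled c keep refl              = ✱L _ (⊢cf-↝ d (↝-fill c (keep ,↝ keep)))
  ... | unfilled c (unfold ✱-unfolds) refl = ⊢cf-↝ d (↝-fill c (keep ,↝ keep))
  ⊢cf-↝ (-✱R d) r = -✱R (⊢cf-↝ d (r ,↝ keep))
  ⊢cf-↝ (-✱L C d₁ d₂) r with ↝-unfill C r
  ... | unfilled c ((r₁ ,↝ r₂) ,↝ keep) refl = -✱L _ (⊢cf-↝ d₁ r₁) (⊢cf-↝ d₂ (↝-fill c (r₂ ,↝ keep)))
  ... | unfilled c ((r₁ ,↝ r₂) ,↝ unfold ()) refl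
  ⊢cf-↝ ⊤R ∅a↝ = ⊤R
  ⊢cf-↝ (⊤L C d) r with ↝-unfill C r
  ... | unfilled c keep refl              = ⊤L _ (⊢cf-↝ d (↝-fill c ∅a↝))
  ... | unfilled c (unfold ⊤-unfolds) refl = ⊢cf-↝ d (↝-fill c ∅a↝)
  ⊢cf-↝ (∧R d₁ d₂) (r₁ ⨾↝ r₂) = ∧R (⊢cf-↝ d₁ r₁) (⊢cf-↝ d₂ r₂)
  ⊢cf-↝ (∧L C d) r with ↝-unfill C r
  ... | unfilled c keep refl              = ∧L _ (⊢cf-↝ d (↝-fill c (keep ⨾↝ keep)))
  ... | unfilled c (unfold ∧-unfolds) refl = ⊢cf-↝ d (↝-fill c (keep ⨾↝ keep))
  ⊢cf-↝ (⇒R d) r = ⇒R (⊢cf-↝ d (r ⨾↝ keep))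
  ⊢cf-↝ (⇒L C d₁ d₂) r with ↝-unfill C r
  ... | unfilled c ((r₁ ⨾↝ r₂) ⨾↝ keep) refl = ⇒L _ (⊢cf-↝ d₁ r₁) (⊢cf-↝ d₂ (↝-fill c (r₂ ⨾↝ keep)))
  ... | unfilled c ((r₁ ⨾↝ r₂) ⨾↝ unfold ()) refl
  ⊢cf-↝ (⊥L C) r with ↝-unfill C r
  ... | unfilled c keep refl = ⊥L _
  ... | unfilled c (unfold ()) refl
  ⊢cf-↝ (∨R₁ d) r = ∨R₁ (⊢cf-↝ d r)
  ⊢cf-↝ (∨R₂ d) r = ∨R₂ (⊢cf-↝ d r)
  ⊢cf-↝ (∨L C d₁ d₂) r with ↝-unfill C r
  ... | unfilled c keep refl = ∨L _ (⊢cf-↝ d₁ (↝-fill c keep)) (⊢cf-↝ d₂ (↝-fill c keep))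
  ... | unfilled c (unfold ()) refl

  _↝*_ : Bunch A → Bunch A → Set a
  _↝*_ = Star _↝_

  ⊢cf-↝* : ∀ {Γ Γ' χ} → Γ ⊢cf χ → Γ ↝* Γ' → Γ' ⊢cf χ
  ⊢cf-↝* d ε        = d
  ⊢cf-↝* d (r ◅ rs) = ⊢cf-↝* (⊢cf-↝ d r) rs

  ↝*-fill : ∀ C {X X'} → X ↝* X' → (C [ X ]) ↝* (C [ X' ])
  ↝*-fill C = gmap (C [_]) (↝-fill (↝ᶜ-refl C))

  ⌈⌉-↝* : ∀ Δ → leaf ⌈ Δ ⌉ ↝* Δ
  ⌈⌉-↝* (leaf φ)   = ε
  ⌈⌉-↝* ∅m         = unfold emp-unfolds ◅ ε
  ⌈⌉-↝* ∅a         = unfold ⊤-unfolds ◅ ε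
  ⌈⌉-↝* (Δ₁ ,ᵇ Δ₂) = unfold ✱-unfolds ◅ ↝*-fill (hole ,ˡ _) (⌈⌉-↝* Δ₁) ◅◅ ↝*-fill (Δ₁ ,ʳ hole) (⌈⌉-↝* Δ₂)
  ⌈⌉-↝* (Δ₁ ⨾ᵇ Δ₂) = unfold ∧-unfolds ◅ ↝*-fill (hole ⨾ˡ _) (⌈⌉-↝* Δ₁) ◅◅ ↝*-fill (Δ₁ ⨾ʳ hole) (⌈⌉-↝* Δ₂)

corollary3p5 : ∀ (Atom : Set) (C : Ctx Atom) (Δ : Bunch Atom) (χ : Form Atom)
    → (C [ leaf ⌈ Δ ⌉ ]) ⊢cf χ → (C [ Δ ]) ⊢cf χ
corollary3p5 Atom C Δ χ d = ⊢cf-↝* d (↝*-fill C (⌈⌉-↝* Δ))
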